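{- Let $q$ be a prime power and $\lambda,n,k,t$ positive integers with $1 \le t \le k \le n$, $1 \le \lambda < \binom{n-t}{k-t}_q$, and $(\lambda+1)k - \lambda n \ge t$. Then $\mathcal{A}^r_q(n,k,t;\lambda) \le \lambda$.
   Context: $\binom{a}{b}_q$ denotes the Gaussian binomial coefficient, the number of $b$-dimensional subspaces of $\mathbb{F}_q^a$. A $t$-$(n,k,\lambda)_q$ subspace packing is a collection (possibly a multiset) of $k$-dimensional subspaces (blocks) of $\mathbb{F}_q^n$ such that every $t$-dimensional subspace of $\mathbb{F}_q^n$ is contained in at most $\lambda$ blocks, counted with multiplicity. $\mathcal{A}^r_q(n,k,t;\lambda)$ denotes the maximum number of blocks (counted with multiplicity) in such a packing when repeated blocks are allowed. -}

module Defs where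

open import Level using (0ℓ)
open import Data.Nat using (ℕ; zero; suc; _+_; _*_; _^_; _≤_; _<_)
open import Data.Nat.Primality using (Prime)
open import Data.Fin using (Fin; zero; suc)
open import Data.List using (List; length; lookup)
open import Data.List.Relation.Unary.All using (All)
open import Data.Product using (Σ; ∃; _×_; _,_)
open import Relation.Binary.PropositionalEquality using (_≡_; _≢_)
open import Relation.Nullary using (¬_)
open import Algebra.Structures using (IsCommutativeRing)
open import Function.Bundles using (_⤖_)
open import Function.Definitions using (Injective)

PrimePower : ℕ → Set
PrimePower q = Σ ℕ λ p → Σ ℕ λ m → Prime p × q ≡ p ^ suc m

record FiniteField (q : ℕ) : Set₁ where
  infixl 6 _+F_
  infixl 7 _*F_
  field
    Carrier  : Set
    _+F_ _*F_ : Carrier → Carrier → Carrier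
    -F_      : Carrier → Carrier
    0F 1F    : Carrier
    isCommutativeRing : IsCommutativeRing _≡_ _+F_ _*F_ -F_ 0F 1F
    0≢1      : 0F ≢ 1F
    inverse  : ∀ x → x ≢ 0F → Σ Carrier λ y → x *F y ≡ 1F
    enumeration : Fin q ⤖ Carrier

gauss : ℕ → ℕ → ℕ → ℕ
gauss q zero    zero    = 1
gauss q zero    (suc k) = 0
gauss q (suc n) zero    = 1
gauss q (suc n) (suc k) = gauss q n k + q ^ suc k * gauss q n (suc k)

module _ {q : ℕ} (F : FiniteField q) where
  open FiniteField F

  Vect : ℕ → Set
  Vect n = Fin n → Carrier

  _≗v_ : ∀ {n} → Vect n → Vect n → Set
  v ≗v w = ∀ i → v i ≡ w i

  sumF : ∀ {k} → (Fin k → Carrier) → Carrier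
  sumF {zero}  f = 0F
  sumF {suc k} f = f zero +F sumF (λ i → f (suc i))

  lincomb : ∀ {n k} → (Fin k → Carrier) → (Fin k → Vect n) → Vect n
  lincomb c b j = sumF (λ i → c i *F b i j)

  record Subspace (n : ℕ) : Set₁ where
    field
      mem     : Vect n → Set
      mem-resp : ∀ {v w} → v ≗v w → mem v → mem w
      mem-0   : mem (λ _ → 0F)
      mem-+   : ∀ {v w} → mem v → mem w → mem (λ i → v i +F w i)
      mem-*   : ∀ a {v} → mem v → mem (λ i → a *F v i)
  open Subspace public

  _⊆S_ : ∀ {n} → Subspace n → Subspace n → Set
  U ⊆S W = ∀ v → mem U v → mem W v

  HasDim : ∀ {n} → ℕ → Subspace n → Set
  HasDim {n} k U = Σ (Fin k → Vect n) λ b →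
      (∀ i → mem U (b i))
    × (∀ (c : Fin k → Carrier) → lincomb c b ≗v (λ _ → 0F) → ∀ i → c i ≡ 0F)
    × (∀ v → mem U v → Σ (Fin k → Carrier) λ c → v ≗v lincomb c b)

  -- a t-(n,k,lam)_q subspace packing, repeated blocks allowed (a list = multiset):
  -- all blocks are k-dimensional, and every t-dimensional subspace T lies in at
  -- most lam blocks counted with multiplicity (any family of distinct positions
  -- of blocks containing T has size ≤ lam).
  IsPacking : (n k t lam : ℕ) → List (Subspace n) → Set₁
  IsPacking n k t lam B =
      All (HasDim k) B
    × (∀ (T : Subspace n) → HasDim t T →
         ∀ m (ι : Fin m → Fin (length B)) → Injective _≡_ _≡_ ι →
         (∀ j → T ⊆S lookup B (ι j)) → m ≤ lam)

module Submission where

-- If a packing had λ + 1 blocks U₀, …, U_λ (k-dimensional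
-- subspaces of F_q^n), then by the dimension formula
--   dim (U₀ ∩ ⋯ ∩ U_λ) ≥ (λ + 1)·k − λ·n ≥ t,
-- so some t-dimensional subspace T would lie in λ + 1 blocks, which the packing
-- condition forbids.  Hence a packing has at most λ blocks.

open import Defs
open import Level using (0ℓ)
open import Data.Nat using (ℕ; zero; suc; _+_; _*_; _∸_; _≤_; _<_)
import Data.Nat.Properties as ℕ
open import Data.Fin using (Fin; zero; suc; punchIn; _↑ˡ_; _↑ʳ_; splitAt; inject≤; _≟_)
open import Data.Fin.Properties using (all?; ¬∀⟶∃¬; punchInᵢ≢i; splitAt⁻¹-↑ˡ; splitAt⁻¹-↑ʳ; inject≤-injective; inj⇒≟)
open import Data.Vec.Functional using (_++_; insertAt; removeAt)
open import Data.Vec.Functional.Properties using (lookup-++ˡ; lookup-++ʳ; insertAt-lookup; insertAt-punchIn)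
open import Data.List using (List; length; lookup)
import Data.List.Relation.Unary.All as All
open import Data.List.Membership.Propositional.Properties using (∈-lookup)
open import Data.Sum using (inj₁; inj₂)
open import Data.Empty using (⊥-elim)
open import Data.Product using (Σ; _×_; _,_)
open import Relation.Nullary using (Dec; yes; no)
open import Relation.Binary.PropositionalEquality
open import Algebra.Bundles using (CommutativeRing)
open import Function.Bundles using (Bijection)
open import Function.Construct.Symmetry using (⤖-sym)

-- Arithmetic of the induction: intersecting with one more k-dimensional subspace
-- of F^n keeps the bound  dim ≥ (s+1)·k − s·n  (written without subtraction).
dim-bound-step : ∀ d k n s → suc s * k ≤ d + s * n → suc (suc s) * k ≤ (d + k) ∸ n + suc s * n
dim-bound-step d k n s hyp = begin
  k + suc s * k    ≤⟨ ℕ.+-monoʳ-≤ k hyp ⟩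
  k + (d + s * n)  ≡⟨ sym (ℕ.+-assoc k d (s * n)) ⟩
  (k + d) + s * n  ≡⟨ cong (_+ s * n) (ℕ.+-comm k d) ⟩
  (d + k) + s * n  ≤⟨ ℕ.+-monoˡ-≤ (s * n) (ℕ.m≤n+m∸n (d + k) n) ⟩
  (n + e) + s * n  ≡⟨ cong (_+ s * n) (ℕ.+-comm n e) ⟩
  (e + n) + s * n  ≡⟨ ℕ.+-assoc e n (s * n) ⟩
  e + (n + s * n)  ∎
  where
  open ℕ.≤-Reasoning
  e : ℕ
  e = (d + k) ∸ n

enough-dimensions : ∀ sn {t m d} → sn + t ≤ m → m ≤ d + sn → t ≤ d
enough-dimensions sn {t} {m} {d} t-fits d-bound =
  ℕ.+-cancelˡ-≤ sn t d (ℕ.≤-trans t-fits (ℕ.≤-trans d-bound (ℕ.≤-reflexive (ℕ.+-comm d sn))))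

↑-cases : ∀ {a b} (P : Fin (a + b) → Set) → (∀ i → P (i ↑ˡ b)) → (∀ j → P (a ↑ʳ j)) → ∀ z → P z
↑-cases {a} P left right z with splitAt a z in eq
... | inj₁ i = subst P (splitAt⁻¹-↑ˡ eq) (left i)
... | inj₂ j = subst P (splitAt⁻¹-↑ʳ eq) (right j)

module LinearAlgebra {q : ℕ} (F : FiniteField q) where
  open FiniteField F

  -- The field as a library commutative ring (with propositional equality), so that
  -- the library's ring, group and finite-sum lemmas apply to it.
  ring : CommutativeRing 0ℓ 0ℓ
  ring = record
    { Carrier = Carrier ; _≈_ = _≡_ ; _+_ = _+F_ ; _*_ = _*F_ ; -_ = -F_
    ; 0# = 0F ; 1# = 1F ; isCommutativeRing = isCommutativeRing }

  open CommutativeRing ring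
    using (+-assoc; +-comm; +-identityˡ; +-identityʳ; -‿inverseʳ;
           *-assoc; *-comm; *-identityʳ; zeroˡ; zeroʳ; distribˡ; distribʳ)
  open import Algebra.Properties.Ring (CommutativeRing.ring ring) using (-‿distribˡ-*; -1*x≈-x)
  open import Algebra.Properties.Group (CommutativeRing.+-group ring) using (inverseˡ-unique)
  open import Algebra.Properties.Semiring.Sum (CommutativeRing.semiring ring)
    using (sum; sum-cong-≗; sum-remove; ∑-distrib-+; ∑-comm; *-distribˡ-sum; *-distribʳ-sum)
  open ≡-Reasoning

  -- Field elements have decidable equality, since the field is enumerated by Fin q.
  _≟F_ : (x y : Carrier) → Dec (x ≡ y)
  _≟F_ = inj⇒≟ (Bijection.injection (⤖-sym enumeration))

  sumF≡sum : ∀ {k} (f : Fin k → Carrier) → sumF F f ≡ sum f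
  sumF≡sum {zero}  f = refl
  sumF≡sum {suc k} f = cong (f zero +F_) (sumF≡sum (λ i → f (suc i)))

  sumF-cong : ∀ {k} {f g : Fin k → Carrier} → (∀ i → f i ≡ g i) → sumF F f ≡ sumF F g
  sumF-cong {zero}  eq = refl
  sumF-cong {suc k} eq = cong₂ _+F_ (eq zero) (sumF-cong (λ i → eq (suc i)))

  sumF-zero : ∀ {k} {f : Fin k → Carrier} → (∀ i → f i ≡ 0F) → sumF F f ≡ 0F
  sumF-zero {zero}  z = refl
  sumF-zero {suc k} z = trans (cong₂ _+F_ (z zero) (sumF-zero (λ i → z (suc i)))) (+-identityˡ 0F)

  sumF-split : ∀ {a b} (f : Fin (a + b) → Carrier) →
    sumF F f ≡ sumF F (λ i → f (i ↑ˡ b)) +F sumF F (λ j → f (a ↑ʳ j))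
  sumF-split {zero}  f = sym (+-identityˡ _)
  sumF-split {suc a} f = trans (cong (f zero +F_) (sumF-split {a} (λ i → f (suc i))))
                               (sym (+-assoc _ _ _))

  zeroV : ∀ {n} → Vect F n
  zeroV _ = 0F

  lincomb≡sum : ∀ {k n} (c : Fin k → Carrier) (b : Fin k → Vect F n) j →
    lincomb F c b j ≡ sum (λ i → c i *F b i j)
  lincomb≡sum c b j = sumF≡sum (λ i → c i *F b i j)

  lincomb-congᶜ : ∀ {k n} {c c′ : Fin k → Carrier} (b : Fin k → Vect F n) j →
    (∀ i → c i ≡ c′ i) → lincomb F c b j ≡ lincomb F c′ b j
  lincomb-congᶜ b j eq = sumF-cong (λ i → cong (_*F b i j) (eq i))

  lincomb-congᵛ : ∀ {k n} (c : Fin k → Carrier) (b b′ : Fin k → Vect F n) j →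
    (∀ i → b i j ≡ b′ i j) → lincomb F c b j ≡ lincomb F c b′ j
  lincomb-congᵛ c b b′ j eq = sumF-cong (λ i → cong (c i *F_) (eq i))

  lincomb-zeroᶜ : ∀ {k n} (b : Fin k → Vect F n) j → lincomb F (λ _ → 0F) b j ≡ 0F
  lincomb-zeroᶜ b j = sumF-zero (λ i → zeroˡ (b i j))

  lincomb-zeroᵛ : ∀ {k n} (c : Fin k → Carrier) (b : Fin k → Vect F n) j →
    (∀ i → b i j ≡ 0F) → lincomb F c b j ≡ 0F
  lincomb-zeroᵛ c b j z = sumF-zero (λ i → trans (cong (c i *F_) (z i)) (zeroʳ (c i)))

  lincomb-+ᵛ : ∀ {k n} (c : Fin k → Carrier) (b b′ : Fin k → Vect F n) j →
    lincomb F c (λ i j → b i j +F b′ i j) j ≡ lincomb F c b j +F lincomb F c b′ j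
  lincomb-+ᵛ c b b′ j = begin
    sumF F (λ i → c i *F (b i j +F b′ i j))          ≡⟨ sumF-cong (λ i → distribˡ (c i) _ _) ⟩
    sumF F (λ i → c i *F b i j +F c i *F b′ i j)
      ≡⟨ sumF≡sum (λ i → c i *F b i j +F c i *F b′ i j) ⟩
    sum (λ i → c i *F b i j +F c i *F b′ i j)
      ≡⟨ ∑-distrib-+ (λ i → c i *F b i j) (λ i → c i *F b′ i j) ⟩
    sum (λ i → c i *F b i j) +F sum (λ i → c i *F b′ i j)
      ≡⟨ sym (cong₂ _+F_ (lincomb≡sum c b j) (lincomb≡sum c b′ j)) ⟩
    lincomb F c b j +F lincomb F c b′ j ∎

  lincomb-+ᶜ : ∀ {k n} (c c′ : Fin k → Carrier) (b : Fin k → Vect F n) j →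
    lincomb F (λ i → c i +F c′ i) b j ≡ lincomb F c b j +F lincomb F c′ b j
  lincomb-+ᶜ c c′ b j = begin
    sumF F (λ i → (c i +F c′ i) *F b i j)            ≡⟨ sumF-cong (λ i → distribʳ (b i j) (c i) (c′ i)) ⟩
    sumF F (λ i → c i *F b i j +F c′ i *F b i j)
      ≡⟨ sumF≡sum (λ i → c i *F b i j +F c′ i *F b i j) ⟩
    sum (λ i → c i *F b i j +F c′ i *F b i j)
      ≡⟨ ∑-distrib-+ (λ i → c i *F b i j) (λ i → c′ i *F b i j) ⟩
    sum (λ i → c i *F b i j) +F sum (λ i → c′ i *F b i j)
      ≡⟨ sym (cong₂ _+F_ (lincomb≡sum c b j) (lincomb≡sum c′ b j)) ⟩
    lincomb F c b j +F lincomb F c′ b j ∎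

  lincomb-*ᶜ : ∀ {k n} a (c : Fin k → Carrier) (b : Fin k → Vect F n) j →
    lincomb F (λ i → a *F c i) b j ≡ a *F lincomb F c b j
  lincomb-*ᶜ a c b j = begin
    sumF F (λ i → (a *F c i) *F b i j)  ≡⟨ sumF-cong (λ i → *-assoc a (c i) (b i j)) ⟩
    sumF F (λ i → a *F (c i *F b i j))  ≡⟨ sumF≡sum (λ i → a *F (c i *F b i j)) ⟩
    sum (λ i → a *F (c i *F b i j))     ≡⟨ sym (*-distribˡ-sum a (λ i → c i *F b i j)) ⟩
    a *F sum (λ i → c i *F b i j)       ≡⟨ cong (a *F_) (sym (lincomb≡sum c b j)) ⟩
    a *F lincomb F c b j                ∎

  lincomb-lincomb : ∀ {m d n} (c : Fin m → Carrier) (a : Fin m → Fin d → Carrier) (w : Fin d → Vect F n) j →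
    lincomb F c (λ l → lincomb F (a l) w) j ≡ lincomb F (lincomb F c a) w j
  lincomb-lincomb c a w j = begin
    lincomb F c (λ l → lincomb F (a l) w) j
      ≡⟨ lincomb≡sum c (λ l → lincomb F (a l) w) j ⟩
    sum (λ l → c l *F lincomb F (a l) w j)
      ≡⟨ sum-cong-≗ (λ l → cong (c l *F_) (lincomb≡sum (a l) w j)) ⟩
    sum (λ l → c l *F sum (λ i → a l i *F w i j))
      ≡⟨ sum-cong-≗ (λ l → *-distribˡ-sum (c l) (λ i → a l i *F w i j)) ⟩
    sum (λ l → sum (λ i → c l *F (a l i *F w i j)))
      ≡⟨ ∑-comm (λ l i → c l *F (a l i *F w i j)) ⟩
    sum (λ i → sum (λ l → c l *F (a l i *F w i j)))
      ≡⟨ sum-cong-≗ (λ i → sum-cong-≗ (λ l → sym (*-assoc (c l) (a l i) (w i j)))) ⟩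
    sum (λ i → sum (λ l → (c l *F a l i) *F w i j))
      ≡⟨ sum-cong-≗ (λ i → sym (*-distribʳ-sum (w i j) (λ l → c l *F a l i))) ⟩
    sum (λ i → sum (λ l → c l *F a l i) *F w i j)
      ≡⟨ sum-cong-≗ (λ i → cong (_*F w i j) (sym (sumF≡sum (λ l → c l *F a l i)))) ⟩
    sum (λ i → lincomb F c a i *F w i j)
      ≡⟨ sym (lincomb≡sum (lincomb F c a) w j) ⟩
    lincomb F (lincomb F c a) w j ∎

  lincomb-split : ∀ {a b n} (c : Fin (a + b) → Carrier) (f : Fin (a + b) → Vect F n) j →
    lincomb F c f j ≡ lincomb F (λ i → c (i ↑ˡ b)) (λ i → f (i ↑ˡ b)) j
                      +F lincomb F (λ i → c (a ↑ʳ i)) (λ i → f (a ↑ʳ i)) j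
  lincomb-split {a} {b} c f j = sumF-split {a} {b} (λ i → c i *F f i j)

  lincomb-remove : ∀ {k n} (p : Fin (suc k)) (c : Fin (suc k) → Carrier) (b : Fin (suc k) → Vect F n) j →
    lincomb F c b j ≡ c p *F b p j +F lincomb F (removeAt c p) (removeAt b p) j
  lincomb-remove p c b j = begin
    lincomb F c b j                                 ≡⟨ lincomb≡sum c b j ⟩
    sum (λ i → c i *F b i j)                        ≡⟨ sum-remove {i = p} (λ i → c i *F b i j) ⟩
    c p *F b p j +F sum (λ i → c (punchIn p i) *F b (punchIn p i) j)
      ≡⟨ cong (c p *F b p j +F_) (sym (lincomb≡sum (removeAt c p) (removeAt b p) j)) ⟩
    c p *F b p j +F lincomb F (removeAt c p) (removeAt b p) j ∎

  lincomb-mem : ∀ {k n} (U : Subspace F n) (c : Fin k → Carrier) (b : Fin k → Vect F n) →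
    (∀ i → mem U (b i)) → mem U (lincomb F c b)
  lincomb-mem {zero}  U c b bU = mem-0 U
  lincomb-mem {suc k} U c b bU =
    mem-+ U (mem-* U (c zero) (bU zero)) (lincomb-mem U (λ i → c (suc i)) (λ i → b (suc i)) (λ i → bU (suc i)))

  δ : ∀ {N} → Fin N → Fin N → Carrier
  δ l i with l ≟ i
  ... | yes _ = 1F
  ... | no  _ = 0F

  δ-diag : ∀ {N} (i : Fin N) → δ i i ≡ 1F
  δ-diag i with i ≟ i
  ... | yes _  = refl
  ... | no i≢i = ⊥-elim (i≢i refl)

  -- δ j i = 0 for j ≠ i (every j ≠ i is some punchIn i j).
  δ-off : ∀ {N} (i : Fin (suc N)) j → δ (punchIn i j) i ≡ 0F
  δ-off i j with punchIn i j ≟ i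
  ... | yes eq = ⊥-elim (punchInᵢ≢i i j eq)
  ... | no  _  = refl

  lincomb-δ : ∀ {N} (c : Fin N → Carrier) i → lincomb F c δ i ≡ c i
  lincomb-δ {suc N} c i = begin
    lincomb F c δ i
      ≡⟨ lincomb-remove i c δ i ⟩
    c i *F δ i i +F lincomb F (removeAt c i) (removeAt δ i) i
      ≡⟨ cong₂ _+F_ (trans (cong (c i *F_) (δ-diag i)) (*-identityʳ (c i)))
                    (lincomb-zeroᵛ (removeAt c i) (removeAt δ i) i (δ-off i)) ⟩
    c i +F 0F
      ≡⟨ +-identityʳ (c i) ⟩
    c i ∎

  Indep : ∀ {m n} → (Fin m → Vect F n) → Set
  Indep {m} b = ∀ (c : Fin m → Carrier) → _≗v_ F (lincomb F c b) zeroV → ∀ i → c i ≡ 0F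

  lincomb-pad : ∀ {r e n} (c : Fin r → Carrier) (a : Fin (r + e) → Vect F n) j →
    lincomb F (c ++ (λ _ → 0F)) a j ≡ lincomb F c (λ i → a (i ↑ˡ e)) j
  lincomb-pad {r} {e} c a j = begin
    lincomb F c′ a j
      ≡⟨ lincomb-split {r} {e} c′ a j ⟩
    lincomb F (λ i → c′ (i ↑ˡ e)) (λ i → a (i ↑ˡ e)) j
      +F lincomb F (λ i → c′ (r ↑ʳ i)) (λ i → a (r ↑ʳ i)) j
      ≡⟨ cong₂ _+F_ (lincomb-congᶜ (λ i → a (i ↑ˡ e)) j (lookup-++ˡ c zeros))
                    (trans (lincomb-congᶜ (λ i → a (r ↑ʳ i)) j (lookup-++ʳ c zeros))
                           (lincomb-zeroᶜ (λ i → a (r ↑ʳ i)) j)) ⟩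
    lincomb F c (λ i → a (i ↑ˡ e)) j +F 0F
      ≡⟨ +-identityʳ _ ⟩
    lincomb F c (λ i → a (i ↑ˡ e)) j ∎
    where
    zeros : Fin e → Carrier
    zeros _ = 0F
    c′ : Fin (r + e) → Carrier
    c′ = c ++ zeros

  indep-prefix : ∀ {r m n} → r ≤ m → (a : Fin m → Vect F n) → Indep a →
    Σ (Fin r → Fin m) λ ι → Indep (λ i → a (ι i))
  indep-prefix {r} h a independent with ℕ.m≤n⇒∃[o]m+o≡n h
  ... | e , refl = (_↑ˡ e) , λ c vanishes i →
    trans (sym (lookup-++ˡ c (λ _ → 0F) i))
          (independent (c ++ (λ _ → 0F)) (λ j → trans (lincomb-pad c a j) (vanishes j)) (i ↑ˡ e))

  -- r independent linear relations among the vectors f: the rows a l are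
  -- independent coefficient vectors with Σᵢ (a l)ᵢ fᵢ = 0.
  Relations : ∀ {N n} → (Fin N → Vect F n) → ℕ → Set
  Relations {N} f r = Σ (Fin r → Vect F N) λ a → (∀ l → _≗v_ F (lincomb F (a l) f) zeroV) × Indep a

  relations-≤ : ∀ {N n r r′} {f : Fin N → Vect F n} → r′ ≤ r → Relations f r → Relations f r′
  relations-≤ r′≤r (a , rel , ind) with indep-prefix r′≤r a ind
  ... | ι , ind′ = (λ l → a (ι l)) , (λ l → rel (ι l)) , ind′

  relations-zeroCol : ∀ {N n r} (f : Fin N → Vect F (suc n)) → (∀ i → f i zero ≡ 0F) →
    Relations (λ i j → f i (suc j)) r → Relations f r
  relations-zeroCol f zeroCol (a , rel , ind) = a , rel′ , ind
    where
    rel′ : ∀ l → _≗v_ F (lincomb F (a l) f) zeroV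
    rel′ l zero    = lincomb-zeroᵛ (a l) f zero zeroCol
    rel′ l (suc j) = rel l j

  lincomb-scaled : ∀ {k n} (b μ : Fin k → Carrier) (v : Vect F n) j →
    lincomb F b (λ i j → μ i *F v j) j ≡ sumF F (λ i → b i *F μ i) *F v j
  lincomb-scaled b μ v j = begin
    sumF F (λ i → b i *F (μ i *F v j))  ≡⟨ sumF-cong (λ i → sym (*-assoc (b i) (μ i) (v j))) ⟩
    sumF F (λ i → (b i *F μ i) *F v j)  ≡⟨ sumF≡sum (λ i → (b i *F μ i) *F v j) ⟩
    sum (λ i → (b i *F μ i) *F v j)     ≡⟨ sym (*-distribʳ-sum (v j) (λ i → b i *F μ i)) ⟩
    sum (λ i → b i *F μ i) *F v j       ≡⟨ cong (_*F v j) (sym (sumF≡sum (λ i → b i *F μ i))) ⟩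
    sumF F (λ i → b i *F μ i) *F v j    ∎

  -- Elimination step: a relation b among gᵢ = f_(p̂ i) + μᵢ f_p becomes a relation
  -- among f by inserting the coefficient Σᵢ bᵢ μᵢ at the pivot p.
  lift : ∀ {N} (p : Fin (suc N)) (μ b : Fin N → Carrier) → Fin (suc N) → Carrier
  lift p μ b = insertAt b p (sumF F (λ i → b i *F μ i))

  lincomb-lift : ∀ {N n} (f : Fin (suc N) → Vect F n) p (μ b : Fin N → Carrier) j →
    lincomb F (lift p μ b) f j ≡ lincomb F b (λ i j → f (punchIn p i) j +F μ i *F f p j) j
  lincomb-lift f p μ b j = begin
    lincomb F (lift p μ b) f j
      ≡⟨ lincomb-remove p (lift p μ b) f j ⟩
    lift p μ b p *F f p j +F lincomb F (removeAt (lift p μ b) p) (removeAt f p) j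
      ≡⟨ cong₂ _+F_ (cong (_*F f p j) (insertAt-lookup b p s))
                    (lincomb-congᶜ (removeAt f p) j (insertAt-punchIn b p s)) ⟩
    s *F f p j +F lincomb F b (removeAt f p) j
      ≡⟨ +-comm _ _ ⟩
    lincomb F b (removeAt f p) j +F s *F f p j
      ≡⟨ cong (lincomb F b (removeAt f p) j +F_) (sym (lincomb-scaled b μ (f p) j)) ⟩
    lincomb F b (removeAt f p) j +F lincomb F b (λ i j → μ i *F f p j) j
      ≡⟨ sym (lincomb-+ᵛ b (removeAt f p) (λ i j → μ i *F f p j) j) ⟩
    lincomb F b (λ i j → f (punchIn p i) j +F μ i *F f p j) j ∎
    where
    s : Carrier
    s = sumF F (λ i → b i *F μ i)

  -- Hence relations among the gᵢ lift to relations among f; lifting is injective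
  -- away from p, so independence is preserved.
  relations-eliminate : ∀ {N n r} (f : Fin (suc N) → Vect F n) p (μ : Fin N → Carrier) →
    Relations (λ i j → f (punchIn p i) j +F μ i *F f p j) r → Relations f r
  relations-eliminate f p μ (a , rel , ind) = (λ l → lift p μ (a l)) , rel′ , ind′
    where
    rel′ : ∀ l → _≗v_ F (lincomb F (lift p μ (a l)) f) zeroV
    rel′ l j = trans (lincomb-lift f p μ (a l) j) (rel l j)
    ind′ : Indep (λ l → lift p μ (a l))
    ind′ c vanishes = ind c (λ i →
      trans (lincomb-congᵛ c a (λ l → removeAt (lift p μ (a l)) p) i
                           (λ l → sym (insertAt-punchIn (a l) p _ i)))
            (vanishes (punchIn p i)))

  -- Choosing μ = −x·a⁻¹ clears the coordinate x against a nonzero pivot a.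
  pivot-clears : ∀ x a y → a *F y ≡ 1F → x +F (-F (x *F y)) *F a ≡ 0F
  pivot-clears x a y ay≡1 = begin
    x +F (-F (x *F y)) *F a  ≡⟨ cong (x +F_) (sym (-‿distribˡ-* (x *F y) a)) ⟩
    x +F -F ((x *F y) *F a)  ≡⟨ cong (λ z → x +F -F z) (*-assoc x y a) ⟩
    x +F -F (x *F (y *F a))  ≡⟨ cong (λ z → x +F -F (x *F z)) (trans (*-comm y a) ay≡1) ⟩
    x +F -F (x *F 1F)        ≡⟨ cong (λ z → x +F -F z) (*-identityʳ x) ⟩
    x +F -F x                ≡⟨ -‿inverseʳ x ⟩
    0F                       ∎

  -- Induction on n: drop a zero first coordinate, or eliminate it
  -- against a pivot vector (Gaussian elimination).
  relations : ∀ n {N} (f : Fin N → Vect F n) → Relations f (N ∸ n)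
  relations zero    f = δ , (λ l ()) , λ c vanishes i → trans (sym (lincomb-δ c i)) (vanishes i)
  relations (suc n) {zero}  f = (λ ()) , (λ ()) , λ c _ ()
  relations (suc n) {suc N} f with all? (λ i → f i zero ≟F 0F)
  ... | yes zeroCol = relations-≤ {f = f} (ℕ.∸-monoˡ-≤ n (ℕ.n≤1+n N))
                        (relations-zeroCol f zeroCol (relations n (λ i j → f i (suc j))))
  ... | no ¬zeroCol with ¬∀⟶∃¬ _ _ (λ i → f i zero ≟F 0F) ¬zeroCol
  ...   | p , pivot with inverse (f p zero) pivot
  ...     | y , fp*y≡1 = relations-eliminate f p μ (relations-zeroCol g cleared (relations n (λ i j → g i (suc j))))
    where
    μ : Fin N → Carrier
    μ i = -F (f (punchIn p i) zero *F y)
    g : Fin N → Vect F (suc n)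
    g i j = f (punchIn p i) j +F μ i *F f p j
    cleared : ∀ i → g i zero ≡ 0F
    cleared i = pivot-clears (f (punchIn p i) zero) (f p zero) y fp*y≡1

  lincomb-++ : ∀ {d k n} (c : Fin (d + k) → Carrier) (w : Fin d → Vect F n) (u : Fin k → Vect F n) j →
    lincomb F c (w ++ u) j ≡ lincomb F (λ i → c (i ↑ˡ k)) w j +F lincomb F (λ i → c (d ↑ʳ i)) u j
  lincomb-++ {d} {k} c w u j = trans (lincomb-split {d} {k} c (w ++ u) j)
    (cong₂ _+F_ (lincomb-congᵛ (λ i → c (i ↑ˡ k)) (λ i → (w ++ u) (i ↑ˡ k)) w j
                               (λ i → cong (λ v → v j) (lookup-++ˡ w u i)))
                (lincomb-congᵛ (λ i → c (d ↑ʳ i)) (λ i → (w ++ u) (d ↑ʳ i)) u j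
                               (λ i → cong (λ v → v j) (lookup-++ʳ w u i))))

  -- Dimension formula for two subspaces: for independent families w (d vectors)
  -- and u (k vectors) in F^n there are (d + k) ∸ n independent combinations of w
  -- lying in every subspace that contains u.  They come from the relations among
  -- w ++ u: if α·w + β·u = 0 then α·w = −β·u.
  intersection : ∀ {d k n} (w : Fin d → Vect F n) (u : Fin k → Vect F n) → Indep w → Indep u →
    Σ (Fin ((d + k) ∸ n) → Fin d → Carrier) λ α →
      Indep (λ l → lincomb F (α l) w) ×
      (∀ (U : Subspace F n) → (∀ i → mem U (u i)) → ∀ l → mem U (lincomb F (α l) w))
  intersection {d} {k} {n} w u w-indep u-indep with relations n (w ++ u)
  ... | a , rel , a-indep = α , x-indep , x-mem
    where
    α : Fin ((d + k) ∸ n) → Fin d → Carrier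
    α l i = a l (i ↑ˡ k)
    β : Fin ((d + k) ∸ n) → Fin k → Carrier
    β l i = a l (d ↑ʳ i)

    α-β : ∀ l j → lincomb F (α l) w j +F lincomb F (β l) u j ≡ 0F
    α-β l j = trans (sym (lincomb-++ (a l) w u j)) (rel l j)

    x-mem : ∀ (U : Subspace F n) → (∀ i → mem U (u i)) → ∀ l → mem U (lincomb F (α l) w)
    x-mem U u∈U l = mem-resp U (λ j → trans (-1*x≈-x _) (sym (inverseˡ-unique _ _ (α-β l j))))
                               (mem-* U (-F 1F) (lincomb-mem U (β l) u u∈U))

    x-indep : Indep (λ l → lincomb F (α l) w)
    x-indep c vanishes = a-indep c A-zero
      where
      A : Fin (d + k) → Carrier
      A = lincomb F c a
      A-left : ∀ i → A (i ↑ˡ k) ≡ 0F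
      A-left = w-indep (λ i → A (i ↑ˡ k)) (λ j → trans (sym (lincomb-lincomb c α w j)) (vanishes j))
      A-relation : ∀ j → lincomb F A (w ++ u) j ≡ 0F
      A-relation j = trans (sym (lincomb-lincomb c a (w ++ u) j))
                           (lincomb-zeroᵛ c (λ l → lincomb F (a l) (w ++ u)) j (λ l → rel l j))
      A-right : ∀ i → A (d ↑ʳ i) ≡ 0F
      A-right = u-indep (λ i → A (d ↑ʳ i)) (λ j → begin
        lincomb F (λ i → A (d ↑ʳ i)) u j
          ≡⟨ sym (+-identityˡ _) ⟩
        0F +F lincomb F (λ i → A (d ↑ʳ i)) u j
          ≡⟨ cong (_+F lincomb F (λ i → A (d ↑ʳ i)) u j)
                  (sym (trans (lincomb-congᶜ w j A-left) (lincomb-zeroᶜ w j))) ⟩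
        lincomb F (λ i → A (i ↑ˡ k)) w j +F lincomb F (λ i → A (d ↑ʳ i)) u j
          ≡⟨ sym (lincomb-++ A w u j) ⟩
        lincomb F A (w ++ u) j
          ≡⟨ A-relation j ⟩
        0F ∎)
      A-zero : ∀ z → A z ≡ 0F
      A-zero = ↑-cases (λ z → A z ≡ 0F) A-left A-right

  common-family : ∀ {n k} s (U : Fin (suc s) → Subspace F n) → (∀ j → HasDim F k (U j)) →
    Σ ℕ λ d → (suc s * k ≤ d + s * n) ×
      Σ (Fin d → Vect F n) λ w → Indep w × (∀ j i → mem (U j) (w i))
  common-family {n} {k} zero U U-dim with U-dim zero
  ... | b , b∈U , b-indep , _ = k , ℕ.≤-refl , b , b-indep , λ { zero i → b∈U i }
  common-family {n} {k} (suc s) U U-dim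
    with common-family s (λ j → U (suc j)) (λ j → U-dim (suc j)) | U-dim zero
  ... | d , bound , w , w-indep , w∈U | u , u∈U₀ , u-indep , _
    with intersection w u w-indep u-indep
  ... | α , x-indep , x∈ = (d + k) ∸ n , dim-bound-step d k n s bound , (λ l → lincomb F (α l) w) , x-indep , x∈U
    where
    x∈U : ∀ j l → mem (U j) (lincomb F (α l) w)
    x∈U zero    l = x∈ (U zero) u∈U₀ l
    x∈U (suc j) l = lincomb-mem (U (suc j)) (α l) w (w∈U j)

  span : ∀ {t n} → (Fin t → Vect F n) → Subspace F n
  span {t} w = record
    { mem      = λ v → Σ (Fin t → Carrier) λ c → ∀ j → v j ≡ lincomb F c w j
    ; mem-resp = λ v≗v′ (c , v≡) → c , λ j → trans (sym (v≗v′ j)) (v≡ j)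
    ; mem-0    = (λ _ → 0F) , λ j → sym (lincomb-zeroᶜ w j)
    ; mem-+    = λ (c , v≡) (c′ , v′≡) → (λ i → c i +F c′ i) , λ j →
                   trans (cong₂ _+F_ (v≡ j) (v′≡ j)) (sym (lincomb-+ᶜ c c′ w j))
    ; mem-*    = λ a (c , v≡) → (λ i → a *F c i) , λ j →
                   trans (cong (a *F_) (v≡ j)) (sym (lincomb-*ᶜ a c w j))
    }

  span-dim : ∀ {t n} (w : Fin t → Vect F n) → Indep w → HasDim F t (span w)
  span-dim w w-indep = w , w∈span , w-indep , λ v v∈span → v∈span
    where
    w∈span : ∀ i → mem (span w) (w i)
    w∈span i = (λ l → δ l i) , λ j →
      sym (trans (sumF-cong (λ l → *-comm (δ l i) (w l j))) (lincomb-δ (λ l → w l j) i))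

  span-⊆ : ∀ {t n} (w : Fin t → Vect F n) (U : Subspace F n) → (∀ i → mem U (w i)) → _⊆S_ F (span w) U
  span-⊆ w U w∈U v (c , v≡) = mem-resp U (λ j → sym (v≡ j)) (lincomb-mem U c w w∈U)

  common-subspace : ∀ {n k} t s (U : Fin (suc s) → Subspace F n) → (∀ j → HasDim F k (U j)) →
    s * n + t ≤ suc s * k → Σ (Subspace F n) λ T → HasDim F t T × (∀ j → _⊆S_ F T (U j))
  common-subspace {n} {k} t s U U-dim t-fits
    with common-family s U U-dim
  ... | d , d-bound , w , w-indep , w∈U
    with indep-prefix (enough-dimensions (s * n) t-fits d-bound) w w-indep
  ... | ι , wι-indep = span (λ i → w (ι i)) , span-dim (λ i → w (ι i)) wι-indep ,
                       λ j → span-⊆ (λ i → w (ι i)) (U j) (λ i → w∈U j (ι i))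

-- A packing with more than λ blocks would have λ + 1 blocks containing a common
-- t-dimensional subspace, contradicting the packing condition.
lemma17 : ∀ {q : ℕ} → PrimePower q → (F : FiniteField q) →
    ∀ (lam n k t : ℕ) → 1 ≤ t → t ≤ k → k ≤ n →
    1 ≤ lam → lam < gauss q (n ∸ t) (k ∸ t) →
    lam * n + t ≤ (lam + 1) * k →
    ∀ (B : List (Subspace F n)) → IsPacking F n k t lam B →
    length B ≤ lam
lemma17 _ F lam n k t _ _ _ _ _ t-fits B (B-dim , packing) with length B ℕ.≤? lam
... | yes few  = few
... | no  many =
  let T , T-dim , T⊆blocks = common
  in  ⊥-elim (ℕ.1+n≰n (packing T T-dim (suc lam) first first-injective T⊆blocks))
  where
  open LinearAlgebra F
  first : Fin (suc lam) → Fin (length B)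
  first j = inject≤ j (ℕ.≰⇒> many)
  first-injective : ∀ {i j} → first i ≡ first j → i ≡ j
  first-injective {i} {j} = inject≤-injective _ _ i j
  blocks : Fin (suc lam) → Subspace F n
  blocks j = lookup B (first j)
  common : Σ (Subspace F n) λ T → HasDim F t T × (∀ j → _⊆S_ F T (blocks j))
  common = common-subspace t lam blocks (λ j → All.lookup B-dim (∈-lookup (first j)))
                           (subst (λ m → lam * n + t ≤ m * k) (ℕ.+-comm lam 1) t-fits)
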